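{- Let $\Sigma$ be an effect signature, $Q$ a complete lattice and $\mathcal{Q}$ a decomposable set of leaf-monotone and Scott tree continuous modalities on $Q$. Then: (1) for $R\subseteq X\times Y$, $S\subseteq A\times B$, functions $f:X\to TA$, $g:Y\to TB$, and trees $t\in TX$, $r\in TY$: if $f(x)\,\mathcal{Q}(S)\,g(y)$ for all $x,y$ with $xRy$, and $t\,\mathcal{Q}(R)\,r$, then $\mu(f^*(t))\,\mathcal{Q}(S)\,\mu(g^*(r))$; (2) for $S\subseteq A\times B$ and any node label of $\Sigma$ with children indexed by a set $K$ (i.e. $\sigma$ with $K=\{1,\dots,n\}$ for $\sigma:\alpha^n\to\alpha$; $\sigma$ with $K=\mathbb{N}$ for $\sigma:\alpha^{\mathbb{N}}\to\alpha$; or $\sigma_m$ with $K=\{1,\dots,n\}$ for $\sigma:\mathbb{N}\times\alpha^n\to\alpha$), and families $(u_k)_{k\in K}$ in $TA$, $(v_k)_{k\in K}$ in $TB$: if $u_k\,\mathcal{Q}(S)\,v_k$ for all $k\in K$, then the tree with that root label and children $(u_k)_k$ is related by $\mathcal{Q}(S)$ to the tree with that root label and children $(v_k)_k$.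
   Context: Effect signature: a set $\Sigma$ of operation symbols, each with an arity of one of the forms $\alpha^n\to\alpha$ ($n\in\mathbb{N}$), $\mathbb{N}\times\alpha^n\to\alpha$, or $\alpha^{\mathbb{N}}\to\alpha$. For a set $X$, $TX$ is the set of effect trees over $X$: labelled, possibly infinite-depth trees whose nodes are either a leaf labelled $\bot$, a leaf labelled by some $x\in X$, a node labelled $\sigma$ with children $t_1,\dots,t_n$ (for $\sigma:\alpha^n\to\alpha$), a node labelled $\sigma$ with children $t_0,t_1,\dots$ (for $\sigma:\alpha^{\mathbb{N}}\to\alpha$), or a node labelled $\sigma_m$ ($m\in\mathbb{N}$) with children $t_1,\dots,t_n$ (for $\sigma:\mathbb{N}\times\alpha^n\to\alpha$). For $h:X\to Y$, $h^*:TX\to TY$ replaces every non-$\bot$ leaf $x$ by $h(x)$. $\mu:TTX\to TX$ flattens a tree of trees by grafting each leaf tree in place of its leaf. Tree order $\sqsubseteq$ on $TX$: $t\sqsubseteq r$ iff $t$ can be obtained from $r$ by pruning (possibly infinitely many) subtrees and labelling the pruning points $\bot$; ascending chains have least upper bounds $\bigsqcup_n t_n$. $Q$ is a complete lattice with order $\le$. A modality $q$ is a function $[\![q]\!]:TQ\to Q$; for $h:X\to Q$, $t\in TX$ write $(t\in q(h)) := [\![q]\!](h^*(t))$. Leaf order on $TQ$: $t\,T(\le)\,r$ iff $r$ is obtained from $t$ by replacing each leaf labelled $a\in Q$ by a leaf labelled some $b\ge a$ ($\bot$ leaves and internal nodes unchanged). $q$ is leaf-monotone if $t\,T(\le)\,r$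 implies $[\![q]\!](t)\le[\![q]\!](r)$; Scott tree continuous if $[\![q]\!](\bigsqcup_n t_n)=\sup_n[\![q]\!](t_n)$ for every ascending chain. For $R\subseteq X\times Y$ and $h:X\to Q$, $(R{\upharpoonright}h)(y):=\sup\{h(x)\mid xRy\}$. Relator: $t\,\mathcal{Q}(R)\,r$ iff for all $q\in\mathcal{Q}$ and $h:X\to Q$, $(t\in q(h))\le(r\in q(R{\upharpoonright}h))$. Preorder $\preceq$ on $TQ$: $t\preceq t'$ iff for all $q\in\mathcal{Q}$ and all monotone $h:Q\to Q$, $(t\in q(h))\le(t'\in q(h))$. $H:TQ\to Q$ is in $\mathrm{QBS}$ if $t\preceq t'$ implies $H(t)\le H(t')$. Preorder $\trianglelefteq$ on $TTQ$: $r\trianglelefteq r'$ iff for all $q\in\mathcal{Q}$, $H\in\mathrm{QBS}$, $(r\in q(H))\le(r'\in q(H))$. $\mathcal{Q}$ is decomposable if $r\trianglelefteq r'$ implies $\mu r\preceq\mu r'$ for all $r,r'\in TTQ$. -}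

module Defs where

open import Data.Nat using (ℕ; zero; suc)
open import Data.List using (List; []; _∷_)
open import Data.Maybe as Maybe using (Maybe; just; nothing)
open import Data.Sum using (_⊎_)
open import Data.Fin as Fin using (Fin)
open import Data.Unit using (⊤)
open import Data.Product using (Σ; _×_; proj₁)
open import Relation.Binary.PropositionalEquality using (_≡_)
open import Relation.Binary.Structures using (IsPartialOrder)

-- The three kinds of arity: α^n → α, ℕ × α^n → α, α^ℕ → α
data Arity : Set where
  plain  : ℕ → Arity
  param  : ℕ → Arity
  count  : Arity

record Signature : Set₁ where
  field
    Op    : Set
    arity : Op → Arity

-- Extra data carried by a node label: the index m for σ_m (param arities)
Param : Arity → Set
Param (plain n) = ⊤
Param (param n) = ℕ
Param count     = ⊤

ArgsOf : Arity → Set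
ArgsOf (plain n) = Fin n
ArgsOf (param n) = Fin n
ArgsOf count     = ℕ

module _ (S : Signature) where
  open Signature S

  record Label : Set where
    constructor lbl
    field
      op  : Op
      prm : Param (arity op)

  Arg : Label → Set
  Arg l = ArgsOf (arity (Label.op l))

  toFin : (n : ℕ) → ℕ → Maybe (Fin n)
  toFin zero    _       = nothing
  toFin (suc n) zero    = just Fin.zero
  toFin (suc n) (suc k) = Maybe.map Fin.suc (toFin n k)

  decodeArg : (a : Arity) → ℕ → Maybe (ArgsOf a)
  decodeArg (plain n) k = toFin n k
  decodeArg (param n) k = toFin n k
  decodeArg count     k = just k

  decode : (l : Label) → ℕ → Maybe (Arg l)
  decode l = decodeArg (arity (Label.op l))

  -- Effect trees (possibly infinite depth), represented by their node
  -- labelling: a tree assigns a node content to every path from the root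
  -- (paths are lists of child indices, encoded as natural numbers).
  -- Only the values at *valid* paths (see Valid) are meaningful; values
  -- at other paths are junk, and two trees are the same effect tree iff
  -- they agree on valid paths.

  data NodeLab (X : Set) : Set where
    botL  : NodeLab X
    leafL : X → NodeLab X
    nodeL : Label → NodeLab X

  Path : Set
  Path = List ℕ

  Tree : Set → Set
  Tree X = Path → NodeLab X

  sub : {X : Set} → Tree X → ℕ → Tree X
  sub t k p = t (k ∷ p)

  data Valid {X : Set} (t : Tree X) : Path → Set where
    root  : Valid t []
    child : ∀ {k p} (l : Label) (a : Arg l) →
            t [] ≡ nodeL l → decode l k ≡ just a →
            Valid (sub t k) p → Valid t (k ∷ p)

module _ {S : Signature} where

  mapLab : {X Y : Set} → (X → Y) → NodeLab S X → NodeLab S Y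
  mapLab h (botL)    = botL
  mapLab h (leafL x) = leafL (h x)
  mapLab h (nodeL l) = nodeL l

  mapT : {X Y : Set} → (X → Y) → Tree S X → Tree S Y
  mapT h t p = mapLab h (t p)

  joinT : {X : Set} → Tree S (Tree S X) → Tree S X
  joinT r p with r []
  joinT r p       | botL    = botL
  joinT r p       | leafL s = s p
  joinT r []      | nodeL l = nodeL l
  joinT r (k ∷ p) | nodeL l = joinT (sub S r k) p

  nodeT : {X : Set} (l : Label S) → (Arg S l → Tree S X) → Tree S X
  nodeT l us []      = nodeL l
  nodeT l us (k ∷ p) with decode S l k
  ... | just a  = us a p
  ... | nothing = botL

  -- Tree order ⊑: t is obtained from r by pruning subtrees (pruning
  -- points labelled ⊥): at every path existing in t, t either has ⊥ or
  -- agrees with r.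
  _⊑_ : {X : Set} → Tree S X → Tree S X → Set
  t ⊑ r = ∀ p → Valid S t p → (t p ≡ botL) ⊎ (t p ≡ r p)

  data LabLe {X : Set} (_≤_ : X → X → Set) : NodeLab S X → NodeLab S X → Set where
    botLe  : LabLe _≤_ botL botL
    leafLe : ∀ {a b} → a ≤ b → LabLe _≤_ (leafL a) (leafL b)
    nodeLe : ∀ {l} → LabLe _≤_ (nodeL l) (nodeL l)

  LeafLe : {X : Set} (_≤_ : X → X → Set) → Tree S X → Tree S X → Set
  LeafLe _≤_ t r = ∀ p → Valid S t p → LabLe _≤_ (t p) (r p)

record CompleteLattice : Set₁ where
  field
    Carrier        : Set
    _≤_            : Carrier → Carrier → Set
    isPartialOrder : IsPartialOrder _≡_ _≤_
    ⨆              : {I : Set} → (I → Carrier) → Carrier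
    ⨆-upper        : {I : Set} (f : I → Carrier) (i : I) → f i ≤ ⨆ f
    ⨆-least        : {I : Set} (f : I → Carrier) (b : Carrier) →
                     (∀ i → f i ≤ b) → ⨆ f ≤ b

-- Modalities. A set 𝒬 of modalities is given as an index type I together
-- with the interpretation ⟦_⟧ : I → TQ → Q.

module _ (S : Signature) (L : CompleteLattice) where
  open CompleteLattice L renaming (Carrier to Q)

  Modality : Set
  Modality = Tree S Q → Q

  LeafMonotone : Modality → Set
  LeafMonotone m = ∀ t r → LeafLe _≤_ t r → m t ≤ m r

  AscendingChain : {X : Set} → (ℕ → Tree S X) → Set
  AscendingChain c = ∀ n → c n ⊑ c (suc n)

  IsLub : {X : Set} → (ℕ → Tree S X) → Tree S X → Set
  IsLub c t = (∀ n → c n ⊑ t) × (∀ u → (∀ n → c n ⊑ u) → t ⊑ u)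

  ScottTreeContinuous : Modality → Set
  ScottTreeContinuous m =
    ∀ (c : ℕ → Tree S Q) → AscendingChain c → ∀ t → IsLub c t →
    m t ≡ ⨆ (λ n → m (c n))

  module _ {I : Set} (⟦_⟧ : I → Modality) where

    _∈⟨_⟩_ : {X : Set} → Tree S X → I → (X → Q) → Q
    t ∈⟨ q ⟩ h = ⟦ q ⟧ (mapT h t)

    restrict : {X Y : Set} → (X → Y → Set) → (X → Q) → Y → Q
    restrict {X} R h y = ⨆ {Σ X (λ x → R x y)} (λ p → h (proj₁ p))

    Relator : {X Y : Set} → (X → Y → Set) → Tree S X → Tree S Y → Set
    Relator R t r = ∀ (q : I) (h : _ → Q) → (t ∈⟨ q ⟩ h) ≤ (r ∈⟨ q ⟩ restrict R h)

    Monotone : (Q → Q) → Set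
    Monotone h = ∀ a b → a ≤ b → h a ≤ h b

    _⪯_ : Tree S Q → Tree S Q → Set
    t ⪯ t' = ∀ (q : I) (h : Q → Q) → Monotone h → (t ∈⟨ q ⟩ h) ≤ (t' ∈⟨ q ⟩ h)

    QBS : (Tree S Q → Q) → Set
    QBS H = ∀ t t' → t ⪯ t' → H t ≤ H t'

    _⊴_ : Tree S (Tree S Q) → Tree S (Tree S Q) → Set
    r ⊴ r' = ∀ (q : I) (H : Tree S Q → Q) → QBS H → (r ∈⟨ q ⟩ H) ≤ (r' ∈⟨ q ⟩ H)

    Decomposable : Set
    Decomposable = ∀ r r' → r ⊴ r' → joinT r ⪯ joinT r'

-- Both parts reduce to decomposability. For (1), the Kleisli extension
-- μ (f* t) seen through h is μ of the tree t whose leaves x carry the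
-- trees h*(f x); relatedness of f x and g y makes these trees ⪯-related,
-- so every QBS-functional H orders them, and 𝒬(R) lifts this to t and r,
-- i.e. the two trees of trees are ⊴-related. Decomposability turns that
-- into ⪯ between the flattened trees, which yields the required
-- inequality for the identity test function. Part (2) is the special case
-- of (1) for the one-layer tree with root l and leaves its child indices.

module Submission where

open import Function using (id; _∘_)
open import Data.Product using (_×_; _,_; proj₁)
open import Data.Maybe using (just; nothing)
open import Data.List using ([]; _∷_)
open import Relation.Binary.Bundles using (Poset)
open import Relation.Binary.Structures using (IsPartialOrder)
open import Relation.Binary.PropositionalEquality
  using (_≡_; refl; sym; cong; subst; _≗_)

open import Defs

module _ {S : Signature} where

  mapLab-∘ : ∀ {X Y Z : Set} (h : Y → Z) (f : X → Y) (c : NodeLab S X) →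
             mapLab h (mapLab f c) ≡ mapLab (h ∘ f) c
  mapLab-∘ h f botL      = refl
  mapLab-∘ h f (leafL x) = refl
  mapLab-∘ h f (nodeL l) = refl

  mapLab-id : ∀ {X : Set} (c : NodeLab S X) → mapLab id c ≡ c
  mapLab-id botL      = refl
  mapLab-id (leafL x) = refl
  mapLab-id (nodeL l) = refl

  mapT-∘ : ∀ {X Y Z : Set} (h : Y → Z) (f : X → Y) (t : Tree S X) →
           mapT h (mapT f t) ≗ mapT (h ∘ f) t
  mapT-∘ h f t p = mapLab-∘ h f (t p)

  mapT-id : ∀ {X : Set} (t : Tree S X) → mapT id t ≗ t
  mapT-id t p = mapLab-id (t p)

  mapT-joinT-mapT : ∀ {X Y Z : Set} (h : Y → Z) (f : X → Tree S Y) (t : Tree S X) →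
                    mapT h (joinT (mapT f t)) ≗ joinT (mapT (mapT h ∘ f) t)
  mapT-joinT-mapT h f t p with t []
  mapT-joinT-mapT h f t p       | botL    = refl
  mapT-joinT-mapT h f t p       | leafL x = refl
  mapT-joinT-mapT h f t []      | nodeL l = refl
  mapT-joinT-mapT h f t (k ∷ p) | nodeL l = mapT-joinT-mapT h f (sub S t k) p

  LabLe-refl : ∀ {X : Set} {_≼_ : X → X → Set} → (∀ {x} → x ≼ x) →
               ∀ (c : NodeLab S X) → LabLe _≼_ c c
  LabLe-refl ≼-refl botL      = botLe
  LabLe-refl ≼-refl (leafL x) = leafLe ≼-refl
  LabLe-refl ≼-refl (nodeL l) = nodeLe

  mapLab-mono : ∀ {X Y : Set} {_≼_ : Y → Y → Set} {h k : X → Y} →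
                (∀ x → h x ≼ k x) →
                ∀ (c : NodeLab S X) → LabLe _≼_ (mapLab h c) (mapLab k c)
  mapLab-mono h≼k botL      = botLe
  mapLab-mono h≼k (leafL x) = leafLe (h≼k x)
  mapLab-mono h≼k (nodeL l) = nodeLe

  leafT : ∀ {X : Set} → X → Tree S X
  leafT x _ = leafL x

  joinT-mapT-nodeT-leafT : ∀ {X : Set} (l : Label S) (us : Arg S l → Tree S X) →
                           joinT (mapT us (nodeT l leafT)) ≗ nodeT l us
  joinT-mapT-nodeT-leafT l us []      = refl
  joinT-mapT-nodeT-leafT l us (k ∷ p) with decode S l k
  ... | just a  = refl
  ... | nothing = refl

module _ (S : Signature) (L : CompleteLattice) {I : Set}
         (⟦_⟧ : I → Modality S L) where

  open CompleteLattice L renaming (Carrier to Q)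
  open IsPartialOrder isPartialOrder using () renaming (refl to ≤-refl)

  poset : Poset _ _ _
  poset = record { isPartialOrder = isPartialOrder }

  open import Relation.Binary.Reasoning.PartialOrder poset

  restrict-upper : ∀ {X Y : Set} (R : X → Y → Set) (h : X → Q) {x y} →
                   R x y → h x ≤ restrict S L ⟦_⟧ R h y
  restrict-upper R h {x} xRy = ⨆-upper (λ p → h (proj₁ p)) (x , xRy)

  restrict-least : ∀ {X Y : Set} (R : X → Y → Set) (h : X → Q) (k : Y → Q) →
                   (∀ {x y} → R x y → h x ≤ k y) →
                   ∀ y → restrict S L ⟦_⟧ R h y ≤ k y
  restrict-least R h k hRk y = ⨆-least _ (k y) (λ { (x , xRy) → hRk xRy })

  module _ (leafMonotone : ∀ q → LeafMonotone S L ⟦ q ⟧) where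

    ⟦⟧-resp-≗ : ∀ q {t r : Tree S Q} → t ≗ r → ⟦ q ⟧ t ≤ ⟦ q ⟧ r
    ⟦⟧-resp-≗ q {t} t≗r =
      leafMonotone q _ _ (λ p _ → subst (LabLe _≤_ (t p)) (t≗r p) (LabLe-refl ≤-refl (t p)))

    ⟦⟧-mapT-mono : ∀ q {X : Set} {h k : X → Q} → (∀ x → h x ≤ k x) →
                   (t : Tree S X) → ⟦ q ⟧ (mapT h t) ≤ ⟦ q ⟧ (mapT k t)
    ⟦⟧-mapT-mono q h≤k t = leafMonotone q _ _ (λ p _ → mapLab-mono h≤k (t p))

    Relator⇒⟦⟧-mapT-≤ : ∀ {X Y : Set} {R : X → Y → Set} {t r} →
                        Relator S L ⟦_⟧ R t r → {h : X → Q} {k : Y → Q} →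
                        (∀ {x y} → R x y → h x ≤ k y) →
                        ∀ q → ⟦ q ⟧ (mapT h t) ≤ ⟦ q ⟧ (mapT k r)
    Relator⇒⟦⟧-mapT-≤ {R = R} {t} {r} tRr {h} {k} hRk q = begin
      ⟦ q ⟧ (mapT h t)                          ≤⟨ tRr q h ⟩
      ⟦ q ⟧ (mapT (restrict S L ⟦_⟧ R h) r)     ≤⟨ ⟦⟧-mapT-mono q (restrict-least R h k hRk) r ⟩
      ⟦ q ⟧ (mapT k r)                          ∎

    Relator⇒⟦⟧-mapT-mapT-≤ : ∀ {X Y Z : Set} {R : X → Y → Set} {t r} →
                             Relator S L ⟦_⟧ R t r →
                             {H : Z → Q} {F : X → Z} {G : Y → Z} →
                             (∀ {x y} → R x y → H (F x) ≤ H (G y)) →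
                             ∀ q → ⟦ q ⟧ (mapT H (mapT F t)) ≤ ⟦ q ⟧ (mapT H (mapT G r))
    Relator⇒⟦⟧-mapT-mapT-≤ {t = t} {r} tRr {H} {F} {G} HFRG q = begin
      ⟦ q ⟧ (mapT H (mapT F t))   ≤⟨ ⟦⟧-resp-≗ q (mapT-∘ H F t) ⟩
      ⟦ q ⟧ (mapT (H ∘ F) t)      ≤⟨ Relator⇒⟦⟧-mapT-≤ tRr HFRG q ⟩
      ⟦ q ⟧ (mapT (H ∘ G) r)      ≤⟨ ⟦⟧-resp-≗ q (sym ∘ mapT-∘ H G r) ⟩
      ⟦ q ⟧ (mapT H (mapT G r))   ∎

    Relator⇒mapT-⪯ : ∀ {A B : Set} {Sr : A → B → Set} {u v} →
                     Relator S L ⟦_⟧ Sr u v → (h : A → Q) →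
                     _⪯_ S L ⟦_⟧ (mapT h u) (mapT (restrict S L ⟦_⟧ Sr h) v)
    Relator⇒mapT-⪯ {Sr = Sr} uSv h q m m-mono =
      Relator⇒⟦⟧-mapT-mapT-≤ uSv (λ aSb → m-mono _ _ (restrict-upper Sr h aSb)) q

    ⪯⇒⟦⟧-≤ : ∀ {t t' : Tree S Q} → _⪯_ S L ⟦_⟧ t t' → ∀ q → ⟦ q ⟧ t ≤ ⟦ q ⟧ t'
    ⪯⇒⟦⟧-≤ {t} {t'} t⪯t' q = begin
      ⟦ q ⟧ t              ≤⟨ ⟦⟧-resp-≗ q (sym ∘ mapT-id t) ⟩
      ⟦ q ⟧ (mapT id t)    ≤⟨ t⪯t' q id (λ _ _ → id) ⟩
      ⟦ q ⟧ (mapT id t')   ≤⟨ ⟦⟧-resp-≗ q (mapT-id t') ⟩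
      ⟦ q ⟧ t'             ∎

    Relator-resp-≗ : ∀ {X Y : Set} {R : X → Y → Set} {t t' r r'} →
                     t ≗ t' → r ≗ r' → Relator S L ⟦_⟧ R t r → Relator S L ⟦_⟧ R t' r'
    Relator-resp-≗ {R = R} {t} {t'} {r} {r'} t≗t' r≗r' tRr q h = begin
      ⟦ q ⟧ (mapT h t')                        ≤⟨ ⟦⟧-resp-≗ q (cong (mapLab h) ∘ sym ∘ t≗t') ⟩
      ⟦ q ⟧ (mapT h t)                         ≤⟨ tRr q h ⟩
      ⟦ q ⟧ (mapT (restrict S L ⟦_⟧ R h) r)    ≤⟨ ⟦⟧-resp-≗ q (cong (mapLab _) ∘ r≗r') ⟩
      ⟦ q ⟧ (mapT (restrict S L ⟦_⟧ R h) r')   ∎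

    Relator-≡-refl : ∀ {X : Set} (t : Tree S X) → Relator S L ⟦_⟧ _≡_ t t
    Relator-≡-refl t q h = ⟦⟧-mapT-mono q (λ x → restrict-upper _≡_ h refl) t

    module _ (decomposable : Decomposable S L ⟦_⟧) where

      Relator-joinT-mapT :
        ∀ {X Y A B : Set} (R : X → Y → Set) (Sr : A → B → Set)
          (f : X → Tree S A) (g : Y → Tree S B) (t : Tree S X) (r : Tree S Y) →
        (∀ x y → R x y → Relator S L ⟦_⟧ Sr (f x) (g y)) →
        Relator S L ⟦_⟧ R t r →
        Relator S L ⟦_⟧ Sr (joinT (mapT f t)) (joinT (mapT g r))
      Relator-joinT-mapT R Sr f g t r fRg tRr q h = begin
        ⟦ q ⟧ (mapT h (joinT (mapT f t)))    ≤⟨ ⟦⟧-resp-≗ q (mapT-joinT-mapT h f t) ⟩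
        ⟦ q ⟧ (joinT (mapT F t))             ≤⟨ ⪯⇒⟦⟧-≤ (decomposable _ _ Ft⊴Gr) q ⟩
        ⟦ q ⟧ (joinT (mapT G r))             ≤⟨ ⟦⟧-resp-≗ q (sym ∘ mapT-joinT-mapT h' g r) ⟩
        ⟦ q ⟧ (mapT h' (joinT (mapT g r)))   ∎
        where
        h' : _ → Q
        h' = restrict S L ⟦_⟧ Sr h

        F : _ → Tree S Q
        F = mapT h ∘ f

        G : _ → Tree S Q
        G = mapT h' ∘ g

        Ft⊴Gr : _⊴_ S L ⟦_⟧ (mapT F t) (mapT G r)
        Ft⊴Gr q' H H-qbs =
          Relator⇒⟦⟧-mapT-mapT-≤ tRr
            (λ {x} {y} xRy → H-qbs _ _ (Relator⇒mapT-⪯ (fRg x y xRy) h)) q'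

      Relator-nodeT :
        ∀ {A B : Set} (Sr : A → B → Set) (l : Label S)
          (us : Arg S l → Tree S A) (vs : Arg S l → Tree S B) →
        (∀ k → Relator S L ⟦_⟧ Sr (us k) (vs k)) →
        Relator S L ⟦_⟧ Sr (nodeT l us) (nodeT l vs)
      Relator-nodeT Sr l us vs usSvs =
        Relator-resp-≗ (joinT-mapT-nodeT-leafT l us) (joinT-mapT-nodeT-leafT l vs)
          (Relator-joinT-mapT _≡_ Sr us vs (nodeT l leafT) (nodeT l leafT)
             (λ { k .k refl → usSvs k }) (Relator-≡-refl (nodeT l leafT)))

corollary24 :
    (S : Signature) (L : CompleteLattice) (I : Set)
    (⟦_⟧ : I → Modality S L) →
    (∀ q → LeafMonotone S L ⟦ q ⟧) →
    (∀ q → ScottTreeContinuous S L ⟦ q ⟧) →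
    Decomposable S L ⟦_⟧ →
    -- (1) compatibility with Kleisli extension
    (∀ {X Y A B : Set} (R : X → Y → Set) (Sr : A → B → Set)
       (f : X → Tree S A) (g : Y → Tree S B) (t : Tree S X) (r : Tree S Y) →
       (∀ x y → R x y → Relator S L ⟦_⟧ Sr (f x) (g y)) →
       Relator S L ⟦_⟧ R t r →
       Relator S L ⟦_⟧ Sr (joinT (mapT f t)) (joinT (mapT g r)))
    ×
    -- (2) compatibility with every node label
    (∀ {A B : Set} (Sr : A → B → Set) (l : Label S)
       (us : Arg S l → Tree S A) (vs : Arg S l → Tree S B) →
       (∀ k → Relator S L ⟦_⟧ Sr (us k) (vs k)) →
       Relator S L ⟦_⟧ Sr (nodeT l us) (nodeT l vs))
corollary24 S L I ⟦_⟧ leafMonotone _ decomposable =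
  Relator-joinT-mapT S L ⟦_⟧ leafMonotone decomposable ,
  Relator-nodeT S L ⟦_⟧ leafMonotone decomposable
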